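{- Let $D$ be a bicolored directed cycle with a chord, with $n$ vertices and base cycle $C$. Then $D$ has a bikernel if and only if one of the following holds. (1) $C$ contains no monochromatic directed path on three vertices (so $n$ is even and the colors alternate along $C$), and, labeling the vertices so that $C=(x_1,x_2,\dots,x_n,x_1)$ and the arcs $(x_{2k-1},x_{2k})$, $1\le k\le n/2$, have color $1$, the chord $(x_i,x_j)$ satisfies: at least one of $i,j$ is odd; if $i$ is even then the chord has color $2$; if $j$ is even then the chord has color $1$. (2) $C$ contains exactly one monochromatic directed path on three vertices, $P=(x,y,z)$, and: if $P$ has color $1$, then the chord is $(v,y)$ for some vertex $v$ and has color $2$; if $P$ has color $2$, then the chord is $(y,v)$ for some vertex $v$ and has color $1$.
   Context: A bicolored directed cycle with a chord is a digraph $D$ consisting of a directed cycle $C$ (the base cycle) together with one additional arc (the chord) joining two non-consecutive vertices of $C$, with every arc colored $1$ or $2$. A path is monochromatic if all its arcs have the same color. A non-empty $B\subseteq V(D)$ is a bikernel (by monochromatic paths) if: (i) for all distinct $u,v\in B$ there is no monochromatic directed $uv$-path; (ii) for every $v\in V(D)\setminus B$ there is a directed path of color $1$ from $v$ to a vertex of $B$; (iii) for every $v\in V(D)\setminus B$ there is a directed path of color $2$ from a vertex of $B$ to $v$. -}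

module Defs where

open import Data.Nat using (ℕ; zero; suc; _+_; _∸_; _%_)
open import Data.Nat.DivMod using (m%n<n)
open import Data.Fin using (Fin; toℕ; fromℕ<)
open import Data.Fin.Subset using (Subset; _∈_; _∉_; Nonempty)
open import Data.Product using (Σ; ∃; _×_; _,_)
open import Data.Sum using (_⊎_)
open import Relation.Nullary using (¬_)
open import Relation.Binary.PropositionalEquality using (_≡_; _≢_)
open import Relation.Binary.Construct.Closure.Transitive using (TransClosure)

data Color : Set where
  c₁ c₂ : Color

-- Vertices of the base cycle are Fin n; the base cycle is 0 → 1 → … → n-1 → 0.
succ : ∀ {n} → Fin n → Fin n
succ {suc m} i = fromℕ< (m%n<n (suc (toℕ i)) (suc m))

record ChordedCycle (n : ℕ) : Set where
  field
    col      : Fin n → Color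
    tail     : Fin n
    head     : Fin n
    chordCol : Color
    distinct : tail ≢ head
    nonconsec₁ : head ≢ succ tail
    nonconsec₂ : tail ≢ succ head
open ChordedCycle public

data Arc {n} (D : ChordedCycle n) : Fin n → Fin n → Color → Set where
  cyc   : ∀ i → Arc D i (succ i) (col D i)
  chord : Arc D (tail D) (head D) (chordCol D)

-- There is a directed walk (of length ≥ 1) of colour c from u to v
-- (equivalently, for u ≠ v, a directed path of colour c).
MonoPath : ∀ {n} → ChordedCycle n → Color → Fin n → Fin n → Set
MonoPath D c = TransClosure (λ x y → Arc D x y c)

record IsBikernel {n} (D : ChordedCycle n) (B : Subset n) : Set where
  field
    nonempty    : Nonempty B
    independent : ∀ u v → u ∈ B → v ∈ B → u ≢ v → ∀ c → ¬ MonoPath D c u v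
    absorbing₁  : ∀ v → v ∉ B → ∃ λ b → b ∈ B × MonoPath D c₁ v b
    dominating₂ : ∀ v → v ∉ B → ∃ λ b → b ∈ B × MonoPath D c₂ b v

HasBikernel : ∀ {n} → ChordedCycle n → Set
HasBikernel {n} D = Σ (Subset n) (IsBikernel D)

-- The monochromatic directed path (i , succ i , succ (succ i)) on C.
MonoP3At : ∀ {n} → ChordedCycle n → Fin n → Set
MonoP3At D i = col D i ≡ col D (succ i)

-- Labelling x_1 = s, x_2 = succ s, …: vertex v is x_{k+1} with k = offset s v.
offset : ∀ {n} → Fin n → Fin n → ℕ
offset {suc m} s v = (toℕ v + (suc m ∸ toℕ s)) % suc m

-- v = x_i with i odd (i = offset + 1, so offset even).
OddLabel : ∀ {n} → Fin n → Fin n → Set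
OddLabel s v = offset s v % 2 ≡ 0

Cond1 : ∀ {n} → ChordedCycle n → Set
Cond1 {n} D =
  (∀ i → ¬ MonoP3At D i) ×
  ∃ λ (s : Fin n) → col D s ≡ c₁ ×
    (OddLabel s (tail D) ⊎ OddLabel s (head D)) ×
    (¬ OddLabel s (tail D) → chordCol D ≡ c₂) ×
    (¬ OddLabel s (head D) → chordCol D ≡ c₁)

-- Condition (2): exactly one monochromatic P3 (i, y, z) on C with y = succ i.
Cond2 : ∀ {n} → ChordedCycle n → Set
Cond2 {n} D = ∃ λ (i : Fin n) →
  MonoP3At D i ×
  (∀ j → MonoP3At D j → j ≡ i) ×
  (col D i ≡ c₁ → head D ≡ succ i × chordCol D ≡ c₂) ×
  (col D i ≡ c₂ → tail D ≡ succ i × chordCol D ≡ c₁)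

-- The colour of a vertex v is col v, the colour of the arc (v, succ v) of C. In a bikernel B every vertex
-- has colour 2 and a predecessor of colour 1: otherwise following C from B, or back into B, yields either a
-- monochromatic path inside B or a vertex that cannot be absorbed or dominated. Hence for a colour-1 P3
-- (x, y, z) the vertex y lies outside B and can be dominated only through the chord, which is therefore
-- (v, y) of colour 2; dually for colour 2. Two such P3s would give the chord two heads, two tails or two
-- colours, so there is at most one, and without P3s the same local analysis at the ends of the chord gives
-- the parity rules of (1). Conversely, the vertices of colour 2 form a bikernel under (1) and in the
-- colour-1 case of (2), and the vertices whose predecessor has colour 1 form one in the colour-2 case.

module Submission where

open import Defs
open import Data.Empty using (⊥-elim)
open import Data.Fin using (Fin; toℕ; fromℕ; inject₁) renaming (zero to fzero; suc to fsuc)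
open import Data.Fin.Properties
  using (toℕ-fromℕ<; toℕ-injective; toℕ-fromℕ; toℕ-inject₁; toℕ≤pred[n]; toℕ<n; any?)
open import Data.Fin.Subset using (Subset; _∈_; _∉_)
open import Data.Fin.Subset.Properties using (_∈?_)
open import Data.Nat using (ℕ; zero; suc; _+_; _∸_; _%_; _<_; _≟_)
open import Data.Nat.DivMod
  using (m%n<n; n%n≡0; m%n%n≡m%n; m≤n⇒m%n≡m; m<n⇒m%n≡m; %-distribˡ-+; [m+n]%n≡m%n)
open import Data.Nat.GeneralisedArithmetic using (iterate)
open import Data.Nat.Properties
  using (0≢1+n; 1+n≢0; 1+n≢n; m≢1+n+m; suc-injective; ≤∧≢⇒<; <⇒≤; +-suc; +-comm; +-assoc; +-identityʳ; m∸n+n≡m)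
open import Data.Product using (∃; _×_; _,_; proj₁; proj₂)
open import Data.Sum using (_⊎_; inj₁; inj₂)
open import Data.Vec using (tabulate)
open import Data.Vec.Properties using (lookup∘tabulate; []=⇒lookup; lookup⇒[]=)
open import Function using (_∘_; case_of_; _⇔_; mk⇔; Equivalence)
open import Relation.Binary.Construct.Closure.Transitive using (TransClosure; [_]; _∷_)
open import Relation.Binary.PropositionalEquality
  using (_≡_; _≢_; refl; sym; trans; cong; subst; module ≡-Reasoning)
open import Relation.Nullary using (¬_; Dec; yes; no; does; contradiction)
open import Relation.Nullary.Decidable using (dec-true)
open import Relation.Unary using (Decidable)

_≟ᶜ_ : (c d : Color) → Dec (c ≡ d)
c₁ ≟ᶜ c₁ = yes refl
c₁ ≟ᶜ c₂ = no λ ()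
c₂ ≟ᶜ c₁ = no λ ()
c₂ ≟ᶜ c₂ = yes refl

≡c₁⇒≢c₂ : ∀ {c} → c ≡ c₁ → c ≢ c₂
≡c₁⇒≢c₂ refl ()

≢c₁⇒≡c₂ : ∀ {c} → c ≢ c₁ → c ≡ c₂
≢c₁⇒≡c₂ {c₁} c≢c₁ = contradiction refl c≢c₁
≢c₁⇒≡c₂ {c₂} _    = refl

≢c₂⇒≡c₁ : ∀ {c} → c ≢ c₂ → c ≡ c₁
≢c₂⇒≡c₁ {c₁} _    = refl
≢c₂⇒≡c₁ {c₂} c≢c₂ = contradiction refl c≢c₂

≢-≢⇒≡ : ∀ {c d e : Color} → c ≢ d → d ≢ e → c ≡ e
≢-≢⇒≡ {c₁} {c₁}      c≢d _   = contradiction refl c≢d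
≢-≢⇒≡ {c₂} {c₂}      c≢d _   = contradiction refl c≢d
≢-≢⇒≡ {c₁} {c₂} {c₁} _   _   = refl
≢-≢⇒≡ {c₁} {c₂} {c₂} _   d≢e = contradiction refl d≢e
≢-≢⇒≡ {c₂} {c₁} {c₁} _   d≢e = contradiction refl d≢e
≢-≢⇒≡ {c₂} {c₁} {c₂} _   _   = refl

[m%n+o]%n≡[m+o]%n : ∀ m o n → (m % suc n + o) % suc n ≡ (m + o) % suc n
[m%n+o]%n≡[m+o]%n m o n = begin
  (m % N + o) % N           ≡⟨ %-distribˡ-+ (m % N) o N ⟩
  (m % N % N + o % N) % N   ≡⟨ cong (λ x → (x + o % N) % N) (m%n%n≡m%n m N) ⟩
  (m % N + o % N) % N       ≡⟨ %-distribˡ-+ m o N ⟨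
  (m + o) % N               ∎
  where open ≡-Reasoning
        N = suc n

module _ {m : ℕ} where

  toℕ-succ : (i : Fin (suc m)) → toℕ (succ i) ≡ suc (toℕ i) % suc m
  toℕ-succ i = toℕ-fromℕ< (m%n<n (suc (toℕ i)) (suc m))

  toℕ-succ-cases : (i : Fin (suc m)) →
    (toℕ i ≡ m × toℕ (succ i) ≡ 0) ⊎ (toℕ i < m × toℕ (succ i) ≡ suc (toℕ i))
  toℕ-succ-cases i with toℕ i ≟ m
  ... | yes i≡m = inj₁ (i≡m , trans (toℕ-succ i) (trans (cong (λ t → suc t % suc m) i≡m) (n%n≡0 (suc m))))
  ... | no  i≢m = inj₂ (i<m , trans (toℕ-succ i) (m≤n⇒m%n≡m i<m))
    where i<m = ≤∧≢⇒< (toℕ≤pred[n] i) i≢m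

  succ-injective : ∀ {i j : Fin (suc m)} → succ i ≡ succ j → i ≡ j
  succ-injective {i} {j} si≡sj with toℕ-succ-cases i | toℕ-succ-cases j | cong toℕ si≡sj
  ... | inj₁ (i≡m , _)    | inj₁ (j≡m , _)    | _ = toℕ-injective (trans i≡m (sym j≡m))
  ... | inj₁ (_ , si≡0)   | inj₂ (_ , sj≡1+j) | e = contradiction (trans (sym si≡0) (trans e sj≡1+j)) 0≢1+n
  ... | inj₂ (_ , si≡1+i) | inj₁ (_ , sj≡0)   | e = contradiction (trans (sym si≡1+i) (trans e sj≡0)) 1+n≢0
  ... | inj₂ (_ , si≡1+i) | inj₂ (_ , sj≡1+j) | e =
    toℕ-injective (suc-injective (trans (sym si≡1+i) (trans e sj≡1+j)))

  prev : Fin (suc m) → Fin (suc m)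
  prev fzero    = fromℕ m
  prev (fsuc i) = inject₁ i

  succ-prev : (v : Fin (suc m)) → succ (prev v) ≡ v
  succ-prev fzero    = toℕ-injective (trans (toℕ-succ (fromℕ m))
    (trans (cong (λ t → suc t % suc m) (toℕ-fromℕ m)) (n%n≡0 (suc m))))
  succ-prev (fsuc i) = toℕ-injective (trans (toℕ-succ (inject₁ i))
    (trans (cong (λ t → suc t % suc m) (toℕ-inject₁ i)) (m≤n⇒m%n≡m (toℕ<n i))))

  prev-succ : (v : Fin (suc m)) → prev (succ v) ≡ v
  prev-succ v = succ-injective (succ-prev (succ v))

  toℕ-iterate-succ : (s : Fin (suc m)) (j : ℕ) → toℕ (iterate succ s j) ≡ (toℕ s + j) % suc m
  toℕ-iterate-succ s zero    = sym (trans (cong (_% suc m) (+-identityʳ (toℕ s))) (m<n⇒m%n≡m (toℕ<n s)))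
  toℕ-iterate-succ s (suc j) = begin
    toℕ (iterate succ (succ s) j)  ≡⟨ toℕ-iterate-succ (succ s) j ⟩
    (toℕ (succ s) + j) % N         ≡⟨ cong (λ x → (x + j) % N) (toℕ-succ s) ⟩
    (suc (toℕ s) % N + j) % N      ≡⟨ [m%n+o]%n≡[m+o]%n (suc (toℕ s)) j m ⟩
    (suc (toℕ s) + j) % N          ≡⟨ cong (_% N) (+-suc (toℕ s) j) ⟨
    (toℕ s + suc j) % N            ∎
    where open ≡-Reasoning
          N = suc m

  iterate-succ-offset : (s v : Fin (suc m)) → iterate succ s (offset s v) ≡ v
  iterate-succ-offset s v = toℕ-injective (begin
    toℕ (iterate succ s (offset s v))  ≡⟨ toℕ-iterate-succ s (offset s v) ⟩
    (toℕ s + x % N) % N                ≡⟨ cong (_% N) (+-comm (toℕ s) (x % N)) ⟩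
    (x % N + toℕ s) % N                ≡⟨ [m%n+o]%n≡[m+o]%n x (toℕ s) m ⟩
    (toℕ v + (N ∸ toℕ s) + toℕ s) % N  ≡⟨ cong (_% N) (+-assoc (toℕ v) (N ∸ toℕ s) (toℕ s)) ⟩
    (toℕ v + (N ∸ toℕ s + toℕ s)) % N  ≡⟨ cong (λ y → (toℕ v + y) % N) (m∸n+n≡m (<⇒≤ (toℕ<n s))) ⟩
    (toℕ v + N) % N                    ≡⟨ [m+n]%n≡m%n (toℕ v) N ⟩
    toℕ v % N                          ≡⟨ m<n⇒m%n≡m (toℕ<n v) ⟩
    toℕ v                              ∎)
    where open ≡-Reasoning
          N = suc m
          x = toℕ v + (N ∸ toℕ s)

succ≢id : ∀ {m} (i : Fin (2 + m)) → succ i ≢ i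
succ≢id i si≡i with toℕ-succ-cases i
... | inj₁ (i≡1+m , si≡0) = 0≢1+n (trans (sym si≡0) (trans (cong toℕ si≡i) i≡1+m))
... | inj₂ (_ , si≡1+i)   = 1+n≢n (trans (sym si≡1+i) (cong toℕ si≡i))

prev≢id : ∀ {m} (v : Fin (2 + m)) → prev v ≢ v
prev≢id v pv≡v = succ≢id v (trans (cong succ (sym pv≡v)) (succ-prev v))

succ∘succ≢id : ∀ {m} (i : Fin (3 + m)) → succ (succ i) ≢ i
succ∘succ≢id i ssi≡i with toℕ-succ-cases i | toℕ-succ-cases (succ i) | cong toℕ ssi≡i
... | inj₁ (_ , si≡0)      | inj₁ (si≡2+m , _)    | _ = 0≢1+n (trans (sym si≡0) si≡2+m)
... | inj₁ (i≡2+m , si≡0)  | inj₂ (_ , ssi≡1+si) | e =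
  0≢1+n (suc-injective (trans (cong suc (sym si≡0)) (trans (sym ssi≡1+si) (trans e i≡2+m))))
... | inj₂ (_ , si≡1+i)    | inj₁ (si≡2+m , ssi≡0) | e =
  0≢1+n (suc-injective (trans (sym (trans si≡1+i (cong suc (trans (sym e) ssi≡0)))) si≡2+m))
... | inj₂ (_ , si≡1+i)    | inj₂ (_ , ssi≡1+si) | e =
  m≢1+n+m (toℕ i) (trans (sym e) (trans ssi≡1+si (cong suc si≡1+i)))

module _ {m} (D : ChordedCycle (suc m)) (alternating : ∀ i → ¬ MonoP3At D i) where

  colour-iterate-succ : ∀ s j → col D (iterate succ s j) ≡ col D s ⇔ j % 2 ≡ 0
  colour-iterate-succ s zero          = mk⇔ (λ _ → refl) (λ _ → refl)
  colour-iterate-succ s (suc zero)    = mk⇔ (λ c → contradiction (sym c) (alternating s)) (λ ())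
  colour-iterate-succ s (suc (suc j))
    rewrite ≢-≢⇒≡ (alternating s) (alternating (succ s)) = colour-iterate-succ (succ (succ s)) j

  same-colour⇔odd-label : ∀ s v → col D v ≡ col D s ⇔ OddLabel s v
  same-colour⇔odd-label s v =
    subst (λ w → col D w ≡ col D s ⇔ OddLabel s v) (iterate-succ-offset s v)
          (colour-iterate-succ s (offset s v))

module _ {A : Set} {R : A → A → Set} where

  first-step : ∀ {x y} → TransClosure R x y → ∃ λ z → R x z
  first-step [ r ]   = _ , r
  first-step (r ∷ _) = _ , r

  last-step : ∀ {x y} → TransClosure R x y → ∃ λ z → R z y
  last-step [ r ]   = _ , r
  last-step (_ ∷ p) = last-step p

three-or-more : ∀ {n} → ChordedCycle n → ∃ λ k → n ≡ 3 + k
three-or-more {0} D with tail D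
... | ()
three-or-more {1} D with tail D | head D | distinct D
... | fzero | fzero | t≢h = contradiction refl t≢h
three-or-more {2} D with tail D | head D | distinct D | nonconsec₁ D
... | fzero      | fzero      | t≢h | _      = contradiction refl t≢h
... | fsuc fzero | fsuc fzero | t≢h | _      = contradiction refl t≢h
... | fzero      | fsuc fzero | _   | h≢st   = contradiction refl h≢st
... | fsuc fzero | fzero      | _   | h≢st   = contradiction refl h≢st
three-or-more {suc (suc (suc k))} D = k , refl

module _ {n} {D : ChordedCycle n} where

  arc-view : ∀ {x y c} → Arc D x y c →
    (y ≡ succ x × col D x ≡ c) ⊎ (x ≡ tail D × y ≡ head D × chordCol D ≡ c)
  arc-view (cyc i) = inj₁ (refl , refl)
  arc-view chord   = inj₂ (refl , refl , refl)

  out-arc-view : ∀ {x y c} → Arc D x y c → col D x ≡ c ⊎ (x ≡ tail D × chordCol D ≡ c)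
  out-arc-view a with arc-view a
  ... | inj₁ (_ , cx)       = inj₁ cx
  ... | inj₂ (x≡t , _ , ch) = inj₂ (x≡t , ch)

  cycle-arc : ∀ {x c} → col D x ≡ c → Arc D x (succ x) c
  cycle-arc {x} refl = cyc x

  chord-arc : ∀ {c} → chordCol D ≡ c → Arc D (tail D) (head D) c
  chord-arc refl = chord

module _ {m} (D : ChordedCycle (suc m)) where

  col-succ-prev : ∀ v → col D (succ (prev v)) ≡ col D v
  col-succ-prev v = cong (col D) (succ-prev v)

  col-prev-succ : ∀ v → col D (prev (succ v)) ≡ col D v
  col-prev-succ v = cong (col D) (prev-succ v)

module _ {m} {D : ChordedCycle (suc m)} where

  arc-from-prev : ∀ {v c} → col D (prev v) ≡ c → Arc D (prev v) v c
  arc-from-prev {v} cpv = subst (λ w → Arc D (prev v) w _) (succ-prev v) (cycle-arc cpv)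

  in-arc-view : ∀ {x y c} → Arc D x y c → col D (prev y) ≡ c ⊎ (y ≡ head D × chordCol D ≡ c)
  in-arc-view {x} a with arc-view a
  ... | inj₁ (refl , cx)    = inj₁ (trans (col-prev-succ D x) cx)
  ... | inj₂ (_ , y≡h , ch) = inj₂ (y≡h , ch)

module _ {m} (D : ChordedCycle (suc m)) {P : Fin (suc m) → Set} (P? : Decidable P) where

  private
    members : Subset (suc m)
    members = tabulate (does ∘ P?)

    ∈⇒P : ∀ {v} → v ∈ members → P v
    ∈⇒P {v} v∈ with P? v | trans (sym (lookup∘tabulate (does ∘ P?) v)) ([]=⇒lookup v∈)
    ... | yes p | _ = p
    ... | no _  | ()

    P⇒∈ : ∀ {v} → P v → v ∈ members
    P⇒∈ {v} p = lookup⇒[]= v members (trans (lookup∘tabulate (does ∘ P?) v) (dec-true (P? v) p))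

  bikernel-from-predicate :
    (∀ {x y} → Arc D x y c₁ → ¬ P x) →
    (∀ {x y} → Arc D x y c₂ → ¬ P y) →
    (∀ v → ¬ P v → ∃ λ b → P b × MonoPath D c₁ v b) →
    (∀ v → ¬ P v → ∃ λ b → P b × MonoPath D c₂ b v) →
    HasBikernel D
  bikernel-from-predicate no-c₁-out no-c₂-in absorb dominate = members , record
    { nonempty    = witness (P? fzero)
    ; independent = no-mono-path
    ; absorbing₁  = λ v v∉ → lift (absorb v (v∉ ∘ P⇒∈))
    ; dominating₂ = λ v v∉ → lift (dominate v (v∉ ∘ P⇒∈))
    }
    where
    lift : ∀ {Q : Fin (suc m) → Set} → ∃ (λ b → P b × Q b) → ∃ (λ b → b ∈ members × Q b)
    lift (b , pb , q) = b , P⇒∈ pb , q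

    witness : Dec (P fzero) → ∃ λ b → b ∈ members
    witness (yes p0) = fzero , P⇒∈ p0
    witness (no ¬p0) = let (b , pb , _) = absorb fzero ¬p0 in b , P⇒∈ pb

    no-mono-path : ∀ u v → u ∈ members → v ∈ members → u ≢ v → ∀ c → ¬ MonoPath D c u v
    no-mono-path u v u∈ v∈ _ c₁ path = no-c₁-out (proj₂ (first-step path)) (∈⇒P u∈)
    no-mono-path u v u∈ v∈ _ c₂ path = no-c₂-in (proj₂ (last-step path)) (∈⇒P v∈)

ChordFitsP3 : ∀ {n} → ChordedCycle n → Fin n → Set
ChordFitsP3 D i =
  (col D i ≡ c₁ → head D ≡ succ i × chordCol D ≡ c₂) ×
  (col D i ≡ c₂ → tail D ≡ succ i × chordCol D ≡ c₁)

-- Condition (1) with labels replaced by colours: x_i has an odd label iff its out-arc on C has colour 1.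
AlternatingChord : ∀ {n} → ChordedCycle n → Set
AlternatingChord D =
  (∀ i → ¬ MonoP3At D i) ×
  (col D (tail D) ≡ c₂ → chordCol D ≡ c₂) ×
  (col D (head D) ≡ c₂ → chordCol D ≡ c₁)

module _ {k} {D : ChordedCycle (3 + k)} {B : Subset (3 + k)} (bikernel : IsBikernel D B) where
  open IsBikernel bikernel

  private
    no-path-within : ∀ {u v c} → u ∈ B → v ∈ B → u ≢ v → ¬ MonoPath D c u v
    no-path-within u∈B v∈B u≢v = independent _ _ u∈B v∈B u≢v _

    succ∉ : ∀ {u} → u ∈ B → succ u ∉ B
    succ∉ {u} u∈B su∈B = no-path-within u∈B su∈B (succ≢id u ∘ sym) [ cyc u ]

    ∉⇒out₁ : ∀ {v} → v ∉ B → col D v ≡ c₁ ⊎ (v ≡ tail D × chordCol D ≡ c₁)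
    ∉⇒out₁ v∉B = out-arc-view (proj₂ (first-step (proj₂ (proj₂ (absorbing₁ _ v∉B)))))

    ∉⇒in₂ : ∀ {v} → v ∉ B → col D (prev v) ≡ c₂ ⊎ (v ≡ head D × chordCol D ≡ c₂)
    ∉⇒in₂ v∉B = in-arc-view (proj₂ (last-step (proj₂ (proj₂ (dominating₂ _ v∉B)))))

    tail-out₁ : ∀ {v} → v ∉ B → col D v ≡ c₂ → v ≡ tail D × chordCol D ≡ c₁
    tail-out₁ v∉B cv with ∉⇒out₁ v∉B
    ... | inj₁ cv₁    = contradiction cv (≡c₁⇒≢c₂ cv₁)
    ... | inj₂ chord₁ = chord₁

    succ-head : ∀ {u} → col D u ≡ c₁ → succ u ∉ B → succ u ≡ head D × chordCol D ≡ c₂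
    succ-head {u} cu su∉B with ∉⇒in₂ su∉B
    ... | inj₁ cu₂    = contradiction (trans (sym (col-prev-succ D u)) cu₂) (≡c₁⇒≢c₂ cu)
    ... | inj₂ chord₂ = chord₂

    ∉⇒colour₁ : ∀ {v} → v ∉ B → (v ≡ tail D → chordCol D ≢ c₁) → col D v ≡ c₁
    ∉⇒colour₁ v∉B not-chord with ∉⇒out₁ v∉B
    ... | inj₁ cv₁            = cv₁
    ... | inj₂ (v≡t , chord₁) = contradiction chord₁ (not-chord v≡t)

    ∉⇒prev-colour₂ : ∀ {v} → v ∉ B → (v ≡ head D → chordCol D ≢ c₂) → col D (prev v) ≡ c₂
    ∉⇒prev-colour₂ v∉B not-chord with ∉⇒in₂ v∉B
    ... | inj₁ cpv₂           = cpv₂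
    ... | inj₂ (v≡h , chord₂) = contradiction chord₂ (not-chord v≡h)

  ∈⇒colour₂ : ∀ {v} → v ∈ B → col D v ≡ c₂
  ∈⇒colour₂ {v} v∈B = ≢c₁⇒≡c₂ λ cv →
    let sv≡h , chord₂ = succ-head cv (succ∉ v∈B)
        csv = ∉⇒colour₁ (succ∉ v∈B) (λ _ chord₁ → ≡c₁⇒≢c₂ chord₁ chord₂)
    in case succ (succ v) ∈? B of λ where
      (yes ssv∈B) → no-path-within v∈B ssv∈B (succ∘succ≢id v ∘ sym) (cycle-arc cv ∷ [ cycle-arc csv ])
      (no ssv∉B)  → succ≢id (succ v) (trans (proj₁ (succ-head csv ssv∉B)) (sym sv≡h))

  succ∈⇒colour₁ : ∀ {u} → succ u ∈ B → col D u ≡ c₁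
  succ∈⇒colour₁ {u} su∈B = ≢c₂⇒≡c₁ λ cu →
    let u∉B = λ u∈B → succ∉ u∈B su∈B
        u≡t , chord₁ = tail-out₁ u∉B cu
        cpu = ∉⇒prev-colour₂ u∉B (λ _ chord₂ → ≡c₁⇒≢c₂ chord₁ chord₂)
        pu≢su = λ pu≡su → succ∘succ≢id u (sym (trans (sym (succ-prev u)) (cong succ pu≡su)))
    in case prev u ∈? B of λ where
      (yes pu∈B) → no-path-within pu∈B su∈B pu≢su (arc-from-prev cpu ∷ [ cycle-arc cu ])
      (no pu∉B)  → prev≢id u (trans (proj₁ (tail-out₁ pu∉B cpu)) (sym u≡t))

  tail∈⇒chord₂ : tail D ∈ B → chordCol D ≡ c₂
  tail∈⇒chord₂ t∈B = ≢c₁⇒≡c₂ λ chord₁ →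
    let h∉B = λ h∈B → no-path-within t∈B h∈B (distinct D) [ chord-arc chord₁ ]
        ch  = ∉⇒colour₁ h∉B (λ h≡t _ → distinct D (sym h≡t))
    in case succ (head D) ∈? B of λ where
      (yes sh∈B) → no-path-within t∈B sh∈B (nonconsec₂ D) (chord-arc chord₁ ∷ [ cycle-arc ch ])
      (no sh∉B)  → succ≢id (head D) (proj₁ (succ-head ch sh∉B))

  head∈⇒chord₁ : head D ∈ B → chordCol D ≡ c₁
  head∈⇒chord₁ h∈B = ≢c₂⇒≡c₁ λ chord₂ →
    let t∉B = λ t∈B → no-path-within t∈B h∈B (distinct D) [ chord-arc chord₂ ]
        cpt = ∉⇒prev-colour₂ t∉B (λ t≡h _ → distinct D t≡h)
        pt≢h = λ pt≡h → nonconsec₂ D (trans (sym (succ-prev (tail D))) (cong succ pt≡h))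
    in case prev (tail D) ∈? B of λ where
      (yes pt∈B) → no-path-within pt∈B h∈B pt≢h (arc-from-prev cpt ∷ [ chord-arc chord₂ ])
      (no pt∉B)  → prev≢id (tail D) (proj₁ (tail-out₁ pt∉B cpt))

  bikernel⇒chord-fits-P3 : ∀ j → MonoP3At D j → ChordFitsP3 D j
  bikernel⇒chord-fits-P3 j p3 = fits₁ , fits₂
    where
    fits₁ : col D j ≡ c₁ → head D ≡ succ j × chordCol D ≡ c₂
    fits₁ cj =
      let sj∉B = λ sj∈B → ≡c₁⇒≢c₂ (trans (sym p3) cj) (∈⇒colour₂ sj∈B)
          sj≡h , chord₂ = succ-head cj sj∉B
      in sym sj≡h , chord₂
    fits₂ : col D j ≡ c₂ → tail D ≡ succ j × chordCol D ≡ c₁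
    fits₂ cj =
      let sj∉B = λ sj∈B → ≡c₁⇒≢c₂ (succ∈⇒colour₁ sj∈B) cj
          sj≡t , chord₁ = tail-out₁ sj∉B (trans (sym p3) cj)
      in sym sj≡t , chord₁

  bikernel⇒tail-rule : (∀ i → ¬ MonoP3At D i) → col D (tail D) ≡ c₂ → chordCol D ≡ c₂
  bikernel⇒tail-rule alternating ct with tail D ∈? B
  ... | yes t∈B = tail∈⇒chord₂ t∈B
  ... | no t∉B  = contradiction (trans cpt (trans (sym ct) (sym (col-succ-prev D (tail D)))))
                                (alternating (prev (tail D)))
    where cpt = ∉⇒prev-colour₂ t∉B (λ t≡h _ → distinct D t≡h)

  bikernel⇒head-rule : col D (head D) ≡ c₂ → chordCol D ≡ c₁
  bikernel⇒head-rule ch with head D ∈? B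
  ... | yes h∈B = head∈⇒chord₁ h∈B
  ... | no h∉B  = proj₂ (tail-out₁ h∉B ch)

module _ {m} (D : ChordedCycle (suc m)) where

  P3-unique : (∀ j → MonoP3At D j → ChordFitsP3 D j) →
              ∀ {i} → MonoP3At D i → ∀ j → MonoP3At D j → j ≡ i
  P3-unique fits {i} p3i j p3j with col D i | col D j | fits i p3i | fits j p3j
  ... | c₁ | c₁ | fitsᵢ , _ | fitsⱼ , _ = succ-injective (trans (sym (proj₁ (fitsⱼ refl))) (proj₁ (fitsᵢ refl)))
  ... | c₂ | c₂ | _ , fitsᵢ | _ , fitsⱼ = succ-injective (trans (sym (proj₁ (fitsⱼ refl))) (proj₁ (fitsᵢ refl)))
  ... | c₁ | c₂ | fitsᵢ , _ | _ , fitsⱼ = ⊥-elim (≡c₁⇒≢c₂ (proj₂ (fitsⱼ refl)) (proj₂ (fitsᵢ refl)))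
  ... | c₂ | c₁ | _ , fitsᵢ | fitsⱼ , _ = ⊥-elim (≡c₁⇒≢c₂ (proj₂ (fitsᵢ refl)) (proj₂ (fitsⱼ refl)))

  Cond1⇔AlternatingChord : Cond1 D ⇔ AlternatingChord D
  Cond1⇔AlternatingChord = mk⇔ to from
    where
    to : Cond1 D → AlternatingChord D
    to (alternating , s , cs , _ , tail-even , head-even) = alternating , tail-rule , head-rule
      where
      odd⇒c₁ : ∀ {v} → OddLabel s v → col D v ≡ c₁
      odd⇒c₁ {v} odd = trans (Equivalence.from (same-colour⇔odd-label D alternating s v) odd) cs
      tail-rule : col D (tail D) ≡ c₂ → chordCol D ≡ c₂
      tail-rule ct = tail-even (λ odd → ≡c₁⇒≢c₂ (odd⇒c₁ odd) ct)
      head-rule : col D (head D) ≡ c₂ → chordCol D ≡ c₁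
      head-rule ch = head-even (λ odd → ≡c₁⇒≢c₂ (odd⇒c₁ odd) ch)
    from : AlternatingChord D → Cond1 D
    from (alternating , tail-rule , head-rule) = alternating , s , cs , odd-end , tail-even , head-even
      where
      colour₁-vertex : Dec (col D fzero ≡ c₁) → ∃ λ s → col D s ≡ c₁
      colour₁-vertex (yes c0) = fzero , c0
      colour₁-vertex (no c0)  = succ fzero , ≢c₂⇒≡c₁ (alternating fzero ∘ trans (≢c₁⇒≡c₂ c0) ∘ sym)
      s  = proj₁ (colour₁-vertex (col D fzero ≟ᶜ c₁))
      cs = proj₂ (colour₁-vertex (col D fzero ≟ᶜ c₁))
      c₁⇒odd : ∀ {v} → col D v ≡ c₁ → OddLabel s v
      c₁⇒odd {v} cv = Equivalence.to (same-colour⇔odd-label D alternating s v) (trans cv (sym cs))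
      odd-end : OddLabel s (tail D) ⊎ OddLabel s (head D)
      odd-end with col D (tail D) ≟ᶜ c₁ | col D (head D) ≟ᶜ c₁
      ... | yes ct | _      = inj₁ (c₁⇒odd ct)
      ... | no _   | yes ch = inj₂ (c₁⇒odd ch)
      ... | no ct  | no ch  = ⊥-elim (≡c₁⇒≢c₂ (head-rule (≢c₁⇒≡c₂ ch)) (tail-rule (≢c₁⇒≡c₂ ct)))
      tail-even : ¬ OddLabel s (tail D) → chordCol D ≡ c₂
      tail-even even = tail-rule (≢c₁⇒≡c₂ (even ∘ c₁⇒odd))
      head-even : ¬ OddLabel s (head D) → chordCol D ≡ c₁
      head-even even = head-rule (≢c₁⇒≡c₂ (even ∘ c₁⇒odd))

module _ {m} (D : ChordedCycle (2 + m)) (fits : ∀ j → MonoP3At D j → ChordFitsP3 D j) where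

  private
    P3₁⇒head : ∀ {j} → col D j ≡ c₁ → col D (succ j) ≡ c₁ → head D ≡ succ j × chordCol D ≡ c₂
    P3₁⇒head {j} cj csj = proj₁ (fits j (trans cj (sym csj))) cj

    P3₂⇒tail : ∀ {j} → col D j ≡ c₂ → col D (succ j) ≡ c₂ → tail D ≡ succ j × chordCol D ≡ c₁
    P3₂⇒tail {j} cj csj = proj₂ (fits j (trans cj (sym csj))) cj

  colour₂-bikernel :
    (col D (tail D) ≡ c₂ → chordCol D ≡ c₂) →
    (col D (head D) ≡ c₂ → chordCol D ≡ c₁) →
    HasBikernel D
  colour₂-bikernel tail-rule head-rule = bikernel-from-predicate D (λ v → col D v ≟ᶜ c₂)
    no-c₁-out no-c₂-in (λ _ → out-of-colour₁ ∘ ≢c₂⇒≡c₁) (λ _ → into-colour₁ ∘ ≢c₂⇒≡c₁)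
    where
    no-c₁-out : ∀ {x y} → Arc D x y c₁ → col D x ≢ c₂
    no-c₁-out a cx with out-arc-view a
    ... | inj₁ cx₁             = ≡c₁⇒≢c₂ cx₁ cx
    ... | inj₂ (refl , chord₁) = ≡c₁⇒≢c₂ chord₁ (tail-rule cx)

    no-c₂-in : ∀ {x y} → Arc D x y c₂ → col D y ≢ c₂
    no-c₂-in a cy with arc-view a
    ... | inj₁ (refl , cx) =
      let t≡y , chord₁ = P3₂⇒tail cx cy in ≡c₁⇒≢c₂ chord₁ (tail-rule (trans (cong (col D) t≡y) cy))
    ... | inj₂ (_ , refl , chord₂) = ≡c₁⇒≢c₂ (head-rule cy) chord₂

    out-of-colour₁ : ∀ {v} → col D v ≡ c₁ → ∃ λ b → col D b ≡ c₂ × MonoPath D c₁ v b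
    out-of-colour₁ {v} cv with col D (succ v) ≟ᶜ c₂
    ... | yes csv₂ = succ v , csv₂ , [ cycle-arc cv ]
    ... | no csv≢c₂ = succ (succ v) , cssv , cycle-arc cv ∷ [ cycle-arc csv ]
      where
      csv = ≢c₂⇒≡c₁ csv≢c₂
      cssv = ≢c₁⇒≡c₂ λ cssv₁ →
        succ≢id (succ v) (trans (sym (proj₁ (P3₁⇒head csv cssv₁))) (proj₁ (P3₁⇒head cv csv)))

    into-head : chordCol D ≡ c₂ → ∃ λ b → col D b ≡ c₂ × MonoPath D c₂ b (head D)
    into-head chord₂ with col D (tail D) ≟ᶜ c₂
    ... | yes ct₂ = tail D , ct₂ , [ chord-arc chord₂ ]
    ... | no ct≢c₂ = prev (tail D) , cpt , arc-from-prev cpt ∷ [ chord-arc chord₂ ]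
      where
      cpt = ≢c₁⇒≡c₂ λ cpt₁ → distinct D (trans (sym (succ-prev (tail D)))
        (sym (proj₁ (P3₁⇒head cpt₁ (trans (col-succ-prev D (tail D)) (≢c₂⇒≡c₁ ct≢c₂))))))

    into-colour₁ : ∀ {v} → col D v ≡ c₁ → ∃ λ b → col D b ≡ c₂ × MonoPath D c₂ b v
    into-colour₁ {v} cv with col D (prev v) ≟ᶜ c₂
    ... | yes cpv₂ = prev v , cpv₂ , [ arc-from-prev cpv₂ ]
    ... | no cpv≢c₂ = subst (λ w → ∃ λ b → col D b ≡ c₂ × MonoPath D c₂ b w)
                            (trans (proj₁ head-at-v) (succ-prev v)) (into-head (proj₂ head-at-v))
      where head-at-v = P3₁⇒head (≢c₂⇒≡c₁ cpv≢c₂) (trans (col-succ-prev D v) cv)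

  -- Reversing every arc and swapping the two colours turns this construction into colour₂-bikernel.
  prev-colour₁-bikernel :
    (col D (prev (head D)) ≡ c₁ → chordCol D ≡ c₁) →
    (col D (prev (tail D)) ≡ c₁ → chordCol D ≡ c₂) →
    HasBikernel D
  prev-colour₁-bikernel head-rule tail-rule = bikernel-from-predicate D (λ v → col D (prev v) ≟ᶜ c₁)
    no-c₁-out no-c₂-in (λ _ → out-of-prev-colour₂ ∘ ≢c₁⇒≡c₂) (λ _ → into-prev-colour₂ ∘ ≢c₁⇒≡c₂)
    where
    no-c₁-out : ∀ {x y} → Arc D x y c₁ → col D (prev x) ≢ c₁
    no-c₁-out {x} a cpx with out-arc-view a
    ... | inj₁ cx =
      let h≡spx , chord₂ = P3₁⇒head cpx (trans (col-succ-prev D x) cx)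
      in ≡c₁⇒≢c₂ (head-rule (trans (cong (col D ∘ prev) (trans h≡spx (succ-prev x))) cpx)) chord₂
    ... | inj₂ (refl , chord₁) = ≡c₁⇒≢c₂ chord₁ (tail-rule cpx)

    no-c₂-in : ∀ {x y} → Arc D x y c₂ → col D (prev y) ≢ c₁
    no-c₂-in a cpy with in-arc-view a
    ... | inj₁ cpy₂            = ≡c₁⇒≢c₂ cpy cpy₂
    ... | inj₂ (refl , chord₂) = ≡c₁⇒≢c₂ (head-rule cpy) chord₂

    out-of-tail : chordCol D ≡ c₁ → ∃ λ b → col D (prev b) ≡ c₁ × MonoPath D c₁ (tail D) b
    out-of-tail chord₁ with col D (prev (head D)) ≟ᶜ c₁
    ... | yes cph₁ = head D , cph₁ , [ chord-arc chord₁ ]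
    ... | no cph≢c₁ =
      succ (head D) , trans (col-prev-succ D (head D)) ch , chord-arc chord₁ ∷ [ cycle-arc ch ]
      where
      ch = ≢c₂⇒≡c₁ λ ch₂ → distinct D (trans (proj₁ (P3₂⇒tail (≢c₁⇒≡c₂ cph≢c₁)
        (trans (col-succ-prev D (head D)) ch₂))) (succ-prev (head D)))

    out-of-prev-colour₂ : ∀ {v} → col D (prev v) ≡ c₂ → ∃ λ b → col D (prev b) ≡ c₁ × MonoPath D c₁ v b
    out-of-prev-colour₂ {v} cpv with col D v ≟ᶜ c₁
    ... | yes cv₁ = succ v , trans (col-prev-succ D v) cv₁ , [ cycle-arc cv₁ ]
    ... | no cv≢c₁ = subst (λ w → ∃ λ b → col D (prev b) ≡ c₁ × MonoPath D c₁ w b)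
                           (trans (proj₁ tail-at-v) (succ-prev v)) (out-of-tail (proj₂ tail-at-v))
      where tail-at-v = P3₂⇒tail cpv (trans (col-succ-prev D v) (≢c₁⇒≡c₂ cv≢c₁))

    into-prev-colour₂ : ∀ {v} → col D (prev v) ≡ c₂ → ∃ λ b → col D (prev b) ≡ c₁ × MonoPath D c₂ b v
    into-prev-colour₂ {v} cpv with col D (prev (prev v)) ≟ᶜ c₁
    ... | yes cppv₁ = prev v , cppv₁ , [ arc-from-prev cpv ]
    ... | no cppv≢c₁ = prev (prev v) , cpppv , arc-from-prev cppv ∷ [ arc-from-prev cpv ]
      where
      cppv = ≢c₁⇒≡c₂ cppv≢c₁
      cpppv = ≢c₂⇒≡c₁ λ cpppv₂ → prev≢id (prev (prev v)) (succ-injective (trans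
        (sym (proj₁ (P3₂⇒tail cpppv₂ (trans (col-succ-prev D (prev (prev v))) cppv))))
        (proj₁ (P3₂⇒tail cppv (trans (col-succ-prev D (prev v)) cpv)))))

bikernel⇒Cond1⊎Cond2 : ∀ {k} (D : ChordedCycle (3 + k)) → HasBikernel D → Cond1 D ⊎ Cond2 D
bikernel⇒Cond1⊎Cond2 D (_ , bikernel) with any? (λ i → col D i ≟ᶜ col D (succ i))
... | yes (i , p3) = inj₂ (i , p3 , P3-unique D fits p3 , fits i p3)
  where
  fits : ∀ j → MonoP3At D j → ChordFitsP3 D j
  fits = bikernel⇒chord-fits-P3 bikernel
... | no ∄p3 = inj₁ (Equivalence.from (Cond1⇔AlternatingChord D)
  (alternating , bikernel⇒tail-rule bikernel alternating , bikernel⇒head-rule bikernel))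
  where
  alternating : ∀ i → ¬ MonoP3At D i
  alternating i p3 = ∄p3 (i , p3)

Cond1⊎Cond2⇒bikernel : ∀ {m} (D : ChordedCycle (2 + m)) → Cond1 D ⊎ Cond2 D → HasBikernel D
Cond1⊎Cond2⇒bikernel D (inj₁ cond1) =
  let alternating , tail-rule , head-rule = Equivalence.to (Cond1⇔AlternatingChord D) cond1
  in colour₂-bikernel D (λ j p3 → contradiction p3 (alternating j)) tail-rule head-rule
Cond1⊎Cond2⇒bikernel D (inj₂ (i , p3 , unique , fitsᵢ)) = by-colour (col D i ≟ᶜ c₁)
  where
  fits : ∀ j → MonoP3At D j → ChordFitsP3 D j
  fits j p3j = subst (ChordFitsP3 D) (sym (unique j p3j)) fitsᵢ

  by-colour : Dec (col D i ≡ c₁) → HasBikernel D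
  by-colour (yes ci) =
    let h≡si , chord₂ = proj₁ fitsᵢ ci
        ch₁ = trans (cong (col D) h≡si) (trans (sym p3) ci)
    in colour₂-bikernel D fits (λ _ → chord₂) (λ ch → contradiction ch (≡c₁⇒≢c₂ ch₁))
  by-colour (no ci≢c₁) =
    let ci = ≢c₁⇒≡c₂ ci≢c₁
        t≡si , chord₁ = proj₂ fitsᵢ ci
        cpt₂ = trans (cong (col D ∘ prev) t≡si) (trans (col-prev-succ D i) ci)
    in prev-colour₁-bikernel D fits (λ _ → chord₁) (λ cpt → contradiction cpt₂ (≡c₁⇒≢c₂ cpt))

mainTheorem18 : (n : ℕ) (D : ChordedCycle n) →
    (HasBikernel D → Cond1 D ⊎ Cond2 D) × (Cond1 D ⊎ Cond2 D → HasBikernel D)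
mainTheorem18 n D with three-or-more D
... | k , refl = bikernel⇒Cond1⊎Cond2 D , Cond1⊎Cond2⇒bikernel D
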